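{- For a permutation $\pi\in\mathbf{S}_n$, let $\pi'=(n+1)\,\pi(1)\dots\pi(n)$. The mapping $\pi \mapsto \Phi(\pi')$ is a bijection between the suffix arrays of words $w\in\Sigma^n$ and the permutations $\varphi\in\mathbf{S}_{n+1}^c$ with $|\{\,i\in[1,n] : \varphi(i)>\varphi(i+1)\,\}\setminus\{1\}|\leq k-1$. Moreover, given such a $\varphi\in\mathbf{S}_{n+1}^c$, the corresponding suffix array $\pi$ is given by $\pi^{ -1}(i)=\varphi^{i}(1)-1$ for each $i\in[1,n]$.
   Context: $\Sigma$ is an ordered alphabet of size $k$. $\mathbf{S}_m$ is the set of permutations of $[1,m]$ and $\mathbf{S}_m^c$ the set of those with exactly one orbit (cycle). The suffix array of a word $u=u_1\dots u_m$ is the permutation $\pi$ with $\pi(i)=j$ iff $u_j\dots u_m$ is the $i$-th suffix of $u$ in lexicographic order. For $\sigma\in\mathbf{S}_m$ the linking permutation is $\Phi(\sigma)=\sigma^{ -1}(\sigma+1)$, i.e. $\Phi(\sigma)(i)=\sigma^{ -1}(\sigma(i)+1)$ where values are taken cyclically ($m+1\equiv 1$). -}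

module Defs where

open import Data.Nat using (ℕ; zero; suc; _∸_)
open import Data.Fin using (Fin; zero; suc; toℕ; fromℕ; inject₁; _<_; _<?_)
open import Data.Fin.Permutation
  using (Permutation′; permutation; lift₀; flip; _∘ₚ_; _⟨$⟩ʳ_; _⟨$⟩ˡ_)
open import Data.Vec using (Vec; toList)
open import Data.List using (List; drop; filter; length; allFin)
open import Data.List.Relation.Binary.Lex.Strict using (Lex-<)
open import Data.Product using (∃-syntax; _×_)
open import Relation.Binary.PropositionalEquality using (_≡_; refl; cong)
open import Relation.Nullary using (¬?)
open import Relation.Nullary.Decidable using (_×-dec_)
import Data.Nat as ℕ

-- Conventions: [1,m] is represented by Fin m, with the 1-indexed
-- position i corresponding to the Fin element of value i - 1.
-- The alphabet Σ of size k is Fin k with its usual order.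

ix : ∀ {m} → Fin m → ℕ
ix i = suc (toℕ i)

sucCyc : ∀ {m} → Fin (suc m) → Fin (suc m)
sucCyc {zero}  zero    = zero
sucCyc {suc m} zero    = suc zero
sucCyc {suc m} (suc i) = h (sucCyc i)
  where
  h : Fin (suc m) → Fin (suc (suc m))
  h zero    = zero
  h (suc j) = suc (suc j)

predCyc : ∀ {m} → Fin (suc m) → Fin (suc m)
predCyc {m} zero = fromℕ m
predCyc (suc i)  = inject₁ i

private
  pred-fromℕ : ∀ m → sucCyc (fromℕ m) ≡ zero
  pred-fromℕ zero = refl
  pred-fromℕ (suc m) rewrite pred-fromℕ m = refl

  suc-inject : ∀ {m} (i : Fin m) → sucCyc (inject₁ i) ≡ suc i
  suc-inject {suc m} zero = refl
  suc-inject {suc m} (suc i) rewrite suc-inject i = refl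

  sp : ∀ {m} (i : Fin (suc m)) → sucCyc (predCyc i) ≡ i
  sp {m} zero = pred-fromℕ m
  sp (suc i) = suc-inject i

  ps : ∀ {m} (i : Fin (suc m)) → predCyc (sucCyc i) ≡ i
  ps {zero} zero = refl
  ps {suc m} zero = refl
  ps {suc m} (suc i) with sucCyc i | ps i
  ... | zero  | e = cong suc e
  ... | suc j | e = cong suc e

sucPerm : ∀ {m} → Permutation′ (suc m)
sucPerm = permutation sucCyc predCyc sp ps

-- π' = (n+1) π(1) … π(n)  in one-line notation:
-- π'(1) = n+1 and π'(i+1) = π(i).

_′ : ∀ {n} → Permutation′ n → Permutation′ (suc n)
π ′ = lift₀ π ∘ₚ flip sucPerm

-- Linking permutation Φ(σ)(i) = σ⁻¹(σ(i)+1), values taken cyclically.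
-- (σ ∘ₚ τ applies σ first, then τ.)
Φ : ∀ {m} → Permutation′ (suc m) → Permutation′ (suc m)
Φ σ = σ ∘ₚ sucPerm ∘ₚ flip σ

Word : ℕ → ℕ → Set
Word k n = Vec (Fin k) n

suffix : ∀ {k n} → Word k n → Fin n → List (Fin k)
suffix w j = drop (toℕ j) (toList w)

_<lex_ : ∀ {k} → List (Fin k) → List (Fin k) → Set
_<lex_ = Lex-< _≡_ _<_

IsSuffixArray : ∀ {k n} → Word k n → Permutation′ n → Set
IsSuffixArray w π = ∀ i j → i < j → suffix w (π ⟨$⟩ʳ i) <lex suffix w (π ⟨$⟩ʳ j)

IsSuffixArrayOfWord : (k : ℕ) → ∀ {n} → Permutation′ n → Set
IsSuffixArrayOfWord k {n} π = ∃[ w ] IsSuffixArray {k} {n} w π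

iter : ∀ {A : Set} → ℕ → (A → A) → A → A
iter zero    f x = x
iter (suc t) f x = f (iter t f x)

IsCyclic : ∀ {m} → Permutation′ (suc m) → Set
IsCyclic φ = ∀ i j → ∃[ t ] iter t (φ ⟨$⟩ʳ_) i ≡ j

-- |{ i ∈ [1,n] : φ(i) > φ(i+1) } ∖ {1}|  for φ ∈ S_{n+1};
-- the 1-indexed i corresponds to i₀ : Fin n, i = i₀ + 1, and i = 1 ↔ i₀ = zero.
descentsExcept1 : ∀ {n} → Permutation′ (suc n) → ℕ
descentsExcept1 {n} φ =
  length (filter (λ i → ¬? (toℕ i ℕ.≟ 0) ×-dec ((φ ⟨$⟩ʳ suc i) <? (φ ⟨$⟩ʳ inject₁ i)))
                 (allFin n))

-- Φ(σ) = σ⁻¹ ∘ (v ↦ v + 1) ∘ σ is conjugate to the cyclic shift, hence always cyclic, and when σ(1) = n + 1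
-- (as for σ = π′) the orbit of 1 lists σ⁻¹: σ⁻¹(v) = Φ(σ)^v(1). This gives injectivity and the formula for π⁻¹.
-- Conversely, for a cyclic φ the orbit of 1 is all of [1, n + 1], and σ⁻¹(v) := φ^v(1) defines a π′ with
-- Φ(π′) = φ.
--
-- Through σ = π′, the permutation φ = Φ(π′) maps the rank of the suffix starting at p (the empty suffix having
-- rank 1) to the rank of the suffix starting at p + 1. If two consecutive suffixes in sorted order begin with the
-- same letter, their tails are sorted the same way, so φ ascends there; hence every descent of φ other than at 1
-- forces the first letter to increase, and there are at most k - 1 of them. Conversely, giving the suffix of rank
-- r ≥ 2 the number of descents of φ in [2, r - 1] as first letter yields a word whose suffixes compare first by
-- this letter and then by the φ-ranks of their tails, that is, exactly in the order π prescribes.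
module Submission where

open import Data.Empty using (⊥-elim)
open import Data.Fin using (Fin; zero; suc; toℕ; fromℕ; fromℕ<; inject₁; lower₁; _<_; _<?_)
open import Data.Fin.Induction using (<-weakInduction; >-weakInduction)
open import Data.Fin.Permutation
  using ( Permutation′; _≈_; _⟨$⟩ʳ_; _⟨$⟩ˡ_; inverseˡ; inverseʳ; permutation; flip; _∘ₚ_
        ; lift₀; remove; lift₀-remove )
open import Data.Fin.Properties
  using ( toℕ-injective; toℕ-fromℕ; toℕ-inject₁; toℕ-fromℕ<; fromℕ<-cong; inject₁-lower₁; toℕ<n
        ; pigeonhole; injective⇒≤ )
open import Data.List using (List; []; _∷_; [_]; _++_; _∷ʳ_; length; filter; take; drop; allFin)
open import Data.List.Properties
  using ( filter-++; filter-accept; filter-reject; length-++; take-suc-tabulate; take-all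
        ; take++drop≡id; length-tabulate )
open import Data.List.Relation.Binary.Lex using (toSum)
open import Data.List.Relation.Binary.Lex.Strict using (halt; this; next; <-asymmetric)
open import Data.Nat as ℕ using (ℕ; zero; suc; _+_; _∸_; _≤_; z≤n; s≤s; NonZero; >-nonZero)
open import Data.Nat.DivMod using (_%_; _/_; m≡m%n+[m/n]*n; m%n<n)
open import Data.Nat.Properties
  using ( ≤-trans; ≤-reflexive; ≤-antisym; <⇒≤; <-irrefl; <-asym; <-trans; ≤-pred; <-cmp; n≮0
        ; m≤n⇒m<n∨m≡n; m∸n+n≡m; m+[n∸m]≡n; m∸n≤m; m<n⇒0<n∸m; suc-injective; +-comm; +-identityʳ
        ; n<1+n; m≤m+n; ≤∧≢⇒<; ≮⇒≥; ∸-monoˡ-≤; module ≤-Reasoning )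
open import Data.Product using (_×_; _,_; proj₁; proj₂; ∃-syntax)
open import Data.Product.Relation.Binary.Lex.Strict using (×-Lex; ×-transitive)
open import Data.Sum using (_⊎_; inj₁; inj₂)
open import Data.Vec using (Vec; []; _∷_; lookup; toList)
import Data.Vec as Vec
open import Data.Vec.Properties using (lookup∘tabulate)
open import Function using (_∘_; id)
open import Level using (0ℓ)
open import Relation.Binary using (Rel; Transitive; Asymmetric)
open import Relation.Binary.Definitions using (tri<; tri≈; tri>)
open import Relation.Binary.PropositionalEquality
  using (_≡_; _≢_; refl; sym; trans; cong; subst; subst₂; resp₂; isEquivalence; module ≡-Reasoning)
open import Relation.Nullary using (yes; no; ¬_; ¬?)
open import Relation.Nullary.Decidable using (_×-dec_)
open import Relation.Unary using (Pred; Decidable)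

open import Defs

⟨$⟩ʳ-injective : ∀ {n} (ρ : Permutation′ n) {i j} → ρ ⟨$⟩ʳ i ≡ ρ ⟨$⟩ʳ j → i ≡ j
⟨$⟩ʳ-injective ρ e = trans (sym (inverseˡ ρ)) (trans (cong (ρ ⟨$⟩ˡ_) e) (inverseˡ ρ))

⟨$⟩ˡ-cong : ∀ {n} {ρ ρ′ : Permutation′ n} → ρ ≈ ρ′ → ∀ y → ρ ⟨$⟩ˡ y ≡ ρ′ ⟨$⟩ˡ y
⟨$⟩ˡ-cong {ρ = ρ} {ρ′} ρ≈ρ′ y =
  ⟨$⟩ʳ-injective ρ′ (trans (sym (ρ≈ρ′ (ρ ⟨$⟩ˡ y))) (trans (inverseʳ ρ) (sym (inverseʳ ρ′))))

≈-from-⟨$⟩ˡ : ∀ {n} {ρ ρ′ : Permutation′ n} → (∀ y → ρ ⟨$⟩ˡ y ≡ ρ′ ⟨$⟩ˡ y) → ρ ≈ ρ′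
≈-from-⟨$⟩ˡ {ρ = ρ} {ρ′} = ⟨$⟩ˡ-cong {ρ = flip ρ} {flip ρ′}

iter-+ : ∀ {A : Set} s t (f : A → A) x → iter (s + t) f x ≡ iter s f (iter t f x)
iter-+ zero    t f x = refl
iter-+ (suc s) t f x = cong f (iter-+ s t f x)

iter-sucʳ : ∀ {A : Set} t (f : A → A) x → iter (suc t) f x ≡ iter t f (f x)
iter-sucʳ zero    f x = refl
iter-sucʳ (suc t) f x = cong f (iter-sucʳ t f x)

iter-≈ : ∀ {n} {ρ ρ′ : Permutation′ n} → ρ ≈ ρ′ → ∀ t x → iter t (ρ ⟨$⟩ʳ_) x ≡ iter t (ρ′ ⟨$⟩ʳ_) x
iter-≈              ρ≈ρ′ zero    x = refl
iter-≈ {ρ = ρ} {ρ′} ρ≈ρ′ (suc t) x = trans (ρ≈ρ′ _) (cong (ρ′ ⟨$⟩ʳ_) (iter-≈ {ρ = ρ} {ρ′} ρ≈ρ′ t x))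

iter-injective : ∀ {n} (ρ : Permutation′ n) t {x y} → iter t (ρ ⟨$⟩ʳ_) x ≡ iter t (ρ ⟨$⟩ʳ_) y → x ≡ y
iter-injective ρ zero    e = e
iter-injective ρ (suc t) e = iter-injective ρ t (⟨$⟩ʳ-injective ρ e)

sucCyc-inject₁ : ∀ {m} (i : Fin m) → sucCyc (inject₁ i) ≡ suc i
sucCyc-inject₁ {suc m} zero    = refl
sucCyc-inject₁ {suc m} (suc i) rewrite sucCyc-inject₁ i = refl

sucCyc-fromℕ : ∀ m → sucCyc (fromℕ m) ≡ zero
sucCyc-fromℕ zero    = refl
sucCyc-fromℕ (suc m) rewrite sucCyc-fromℕ m = refl

fromℕ-or-inject₁ : ∀ {m} (x : Fin (suc m)) → x ≡ fromℕ m ⊎ ∃[ y ] x ≡ inject₁ y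
fromℕ-or-inject₁ {m} x with m ℕ.≟ toℕ x
... | yes m≡x = inj₁ (toℕ-injective (trans (sym m≡x) (sym (toℕ-fromℕ m))))
... | no  m≢x = inj₂ (lower₁ x m≢x , sym (inject₁-lower₁ x m≢x))

iter-sucCyc-zero : ∀ {m} (b : Fin (suc m)) → iter (toℕ b) sucCyc zero ≡ b
iter-sucCyc-zero = <-weakInduction (λ b → iter (toℕ b) sucCyc zero ≡ b) refl step
  where
  step : ∀ i → iter (toℕ (inject₁ i)) sucCyc zero ≡ inject₁ i → iter (toℕ (suc i)) sucCyc zero ≡ suc i
  step i ih = trans (cong sucCyc (subst (λ t → iter t sucCyc zero ≡ inject₁ i) (toℕ-inject₁ i) ih))
                    (sucCyc-inject₁ i)

iter-sucCyc-period : ∀ m → iter (suc m) sucCyc (zero {m}) ≡ zero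
iter-sucCyc-period m =
  trans (cong sucCyc (subst (λ t → iter t sucCyc zero ≡ fromℕ m) (toℕ-fromℕ m) (iter-sucCyc-zero (fromℕ m))))
        (sucCyc-fromℕ m)

sucPerm-cyclic : ∀ {m} → IsCyclic (sucPerm {m})
sucPerm-cyclic {m} a b = toℕ b + (suc m ∸ toℕ a) , (begin
  iter (toℕ b + (suc m ∸ toℕ a)) sucCyc a
    ≡⟨ iter-+ (toℕ b) _ sucCyc a ⟩
  iter (toℕ b) sucCyc (iter (suc m ∸ toℕ a) sucCyc a)
    ≡⟨ cong (λ x → iter (toℕ b) sucCyc (iter (suc m ∸ toℕ a) sucCyc x)) (sym (iter-sucCyc-zero a)) ⟩
  iter (toℕ b) sucCyc (iter (suc m ∸ toℕ a) sucCyc (iter (toℕ a) sucCyc zero))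
    ≡⟨ cong (iter (toℕ b) sucCyc) (sym (iter-+ (suc m ∸ toℕ a) (toℕ a) sucCyc zero)) ⟩
  iter (toℕ b) sucCyc (iter (suc m ∸ toℕ a + toℕ a) sucCyc zero)
    ≡⟨ cong (λ t → iter (toℕ b) sucCyc (iter t sucCyc zero)) (m∸n+n≡m (<⇒≤ (toℕ<n a))) ⟩
  iter (toℕ b) sucCyc (iter (suc m) sucCyc zero)
    ≡⟨ cong (iter (toℕ b) sucCyc) (iter-sucCyc-period m) ⟩
  iter (toℕ b) sucCyc zero
    ≡⟨ iter-sucCyc-zero b ⟩
  b ∎)
  where open ≡-Reasoning

Φ-iter : ∀ {m} (σ : Permutation′ (suc m)) t x → iter t (Φ σ ⟨$⟩ʳ_) x ≡ σ ⟨$⟩ˡ iter t sucCyc (σ ⟨$⟩ʳ x)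
Φ-iter σ zero    x = sym (inverseˡ σ)
Φ-iter σ (suc t) x = cong (λ y → σ ⟨$⟩ˡ sucCyc y) (trans (cong (σ ⟨$⟩ʳ_) (Φ-iter σ t x)) (inverseʳ σ))

Φ-cyclic : ∀ {m} (σ : Permutation′ (suc m)) → IsCyclic (Φ σ)
Φ-cyclic σ i j =
  let t , e = sucPerm-cyclic (σ ⟨$⟩ʳ i) (σ ⟨$⟩ʳ j)
  in  t , trans (Φ-iter σ t i) (trans (cong (σ ⟨$⟩ˡ_) e) (inverseˡ σ))

Φ-cong : ∀ {m} {σ σ′ : Permutation′ (suc m)} → σ ≈ σ′ → Φ σ ≈ Φ σ′
Φ-cong {σ = σ} {σ′} σ≈σ′ x =
  trans (cong (λ y → σ ⟨$⟩ˡ sucCyc y) (σ≈σ′ x)) (⟨$⟩ˡ-cong {ρ = σ} {σ′} σ≈σ′ (sucCyc (σ′ ⟨$⟩ʳ x)))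

Φ-flip : ∀ {m} (τ φ : Permutation′ (suc m)) →
  (∀ v → τ ⟨$⟩ʳ sucCyc v ≡ φ ⟨$⟩ʳ (τ ⟨$⟩ʳ v)) → Φ (flip τ) ≈ φ
Φ-flip τ φ intertwines x = trans (intertwines (τ ⟨$⟩ˡ x)) (cong (φ ⟨$⟩ʳ_) (inverseʳ τ))

⟨$⟩ˡ-via-Φ-orbit : ∀ {m} (σ : Permutation′ (suc m)) → σ ⟨$⟩ʳ zero ≡ fromℕ m →
  ∀ v → σ ⟨$⟩ˡ v ≡ iter (suc (toℕ v)) (Φ σ ⟨$⟩ʳ_) zero
⟨$⟩ˡ-via-Φ-orbit {m} σ σ0≡m v = sym (begin
  iter (suc (toℕ v)) (Φ σ ⟨$⟩ʳ_) zero
    ≡⟨ Φ-iter σ (suc (toℕ v)) zero ⟩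
  σ ⟨$⟩ˡ iter (suc (toℕ v)) sucCyc (σ ⟨$⟩ʳ zero)
    ≡⟨ cong (σ ⟨$⟩ˡ_) (iter-sucʳ (toℕ v) sucCyc _) ⟩
  σ ⟨$⟩ˡ iter (toℕ v) sucCyc (sucCyc (σ ⟨$⟩ʳ zero))
    ≡⟨ cong (λ x → σ ⟨$⟩ˡ iter (toℕ v) sucCyc (sucCyc x)) σ0≡m ⟩
  σ ⟨$⟩ˡ iter (toℕ v) sucCyc (sucCyc (fromℕ m))
    ≡⟨ cong (λ x → σ ⟨$⟩ˡ iter (toℕ v) sucCyc x) (sucCyc-fromℕ m) ⟩
  σ ⟨$⟩ˡ iter (toℕ v) sucCyc zero
    ≡⟨ cong (σ ⟨$⟩ˡ_) (iter-sucCyc-zero v) ⟩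
  σ ⟨$⟩ˡ v ∎)
  where open ≡-Reasoning

′-⟨$⟩ˡ-inject₁ : ∀ {n} (π : Permutation′ n) i → π ′ ⟨$⟩ˡ inject₁ i ≡ suc (π ⟨$⟩ˡ i)
′-⟨$⟩ˡ-inject₁ π i = cong (lift₀ π ⟨$⟩ˡ_) (sucCyc-inject₁ i)

Φ-′-suc : ∀ {n} (π : Permutation′ n) a → Φ (π ′) ⟨$⟩ʳ suc a ≡ π ′ ⟨$⟩ˡ suc (π ⟨$⟩ʳ a)
Φ-′-suc π a = cong (π ′ ⟨$⟩ˡ_) (sucCyc-inject₁ (π ⟨$⟩ʳ a))

′-surjective : ∀ {n} (σ : Permutation′ (suc n)) → σ ⟨$⟩ʳ zero ≡ fromℕ n → ∃[ π ] π ′ ≈ σ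
′-surjective {n} σ σ0≡n = remove zero τ , λ x → trans (cong predCyc (lift₀-remove τ τ0≡0 x)) (inverseˡ sucPerm)
  where
  τ : Permutation′ (suc n)
  τ = σ ∘ₚ sucPerm
  τ0≡0 : τ ⟨$⟩ʳ zero ≡ zero
  τ0≡0 = trans (cong sucCyc σ0≡n) (sucCyc-fromℕ n)

′-inverse-via-orbit : ∀ {n} (π : Permutation′ n) (φ : Permutation′ (suc n)) → Φ (π ′) ≈ φ →
  ∀ i → ix (π ⟨$⟩ˡ i) ≡ ix (iter (ix i) (φ ⟨$⟩ʳ_) zero) ∸ 1
′-inverse-via-orbit π φ Φπ′≈φ i = cong toℕ (begin
  suc (π ⟨$⟩ˡ i)
    ≡⟨ sym (′-⟨$⟩ˡ-inject₁ π i) ⟩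
  π ′ ⟨$⟩ˡ inject₁ i
    ≡⟨ ⟨$⟩ˡ-via-Φ-orbit (π ′) refl (inject₁ i) ⟩
  iter (suc (toℕ (inject₁ i))) (Φ (π ′) ⟨$⟩ʳ_) zero
    ≡⟨ cong (λ t → iter (suc t) (Φ (π ′) ⟨$⟩ʳ_) zero) (toℕ-inject₁ i) ⟩
  iter (ix i) (Φ (π ′) ⟨$⟩ʳ_) zero
    ≡⟨ iter-≈ {ρ = Φ (π ′)} {φ} Φπ′≈φ (ix i) zero ⟩
  iter (ix i) (φ ⟨$⟩ʳ_) zero ∎)
  where open ≡-Reasoning

Φ-′-injective : ∀ {n} (π₁ π₂ : Permutation′ n) → Φ (π₁ ′) ≈ Φ (π₂ ′) → π₁ ≈ π₂
Φ-′-injective π₁ π₂ Φ≈ = ≈-from-⟨$⟩ˡ {ρ = π₁} {π₂} λ i → toℕ-injective (suc-injective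
  (trans (′-inverse-via-orbit π₁ (Φ (π₂ ′)) Φ≈ i) (sym (′-inverse-via-orbit π₂ (Φ (π₂ ′)) (λ _ → refl) i))))

module _ {n} (φ : Permutation′ (suc n)) (cyclic : IsCyclic φ) where

  orbit : ℕ → Fin (suc n)
  orbit t = iter t (φ ⟨$⟩ʳ_) zero

  orbit-returns : ∀ a d → orbit (a + d) ≡ orbit a → orbit d ≡ zero
  orbit-returns a d e = iter-injective φ a (trans (sym (iter-+ a d _ zero)) e)

  orbit-mod : ∀ d → orbit d ≡ zero → .{{_ : NonZero d}} → ∀ t → orbit (t % d) ≡ orbit t
  orbit-mod d returns t = sym (begin
    orbit t                                      ≡⟨ cong orbit (m≡m%n+[m/n]*n t d) ⟩
    orbit (t % d + t / d ℕ.* d)                  ≡⟨ iter-+ (t % d) (t / d ℕ.* d) _ zero ⟩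
    iter (t % d) (φ ⟨$⟩ʳ_) (orbit (t / d ℕ.* d)) ≡⟨ cong (iter (t % d) (φ ⟨$⟩ʳ_)) (multiples (t / d)) ⟩
    orbit (t % d)                                ∎)
    where
    open ≡-Reasoning
    multiples : ∀ q → orbit (q ℕ.* d) ≡ zero
    multiples zero    = refl
    multiples (suc q) = trans (iter-+ d (q ℕ.* d) _ zero) (trans (cong (iter d (φ ⟨$⟩ʳ_)) (multiples q)) returns)

  orbit-covers : ∀ d → orbit d ≡ zero → .{{_ : NonZero d}} → ∀ j → ∃[ t ] orbit (toℕ {d} t) ≡ j
  orbit-covers d returns j =
    let t , orbit-t≡j = cyclic zero j
    in  fromℕ< (m%n<n t d) , trans (cong orbit (toℕ-fromℕ< (m%n<n t d))) (trans (orbit-mod d returns t) orbit-t≡j)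

  orbit-return-time : ∀ d → orbit d ≡ zero → .{{_ : NonZero d}} → suc n ≤ d
  orbit-return-time d returns = injective⇒≤ {f = time} λ {i} {j} tᵢ≡tⱼ → begin
    i                   ≡⟨ sym (proj₂ (orbit-covers d returns i)) ⟩
    orbit (toℕ (time i)) ≡⟨ cong (orbit ∘ toℕ) tᵢ≡tⱼ ⟩
    orbit (toℕ (time j)) ≡⟨ proj₂ (orbit-covers d returns j) ⟩
    j                   ∎
    where
    open ≡-Reasoning
    time : Fin (suc n) → Fin d
    time j = proj₁ (orbit-covers d returns j)

  orbit-period : orbit (suc n) ≡ zero
  orbit-period with pigeonhole (n<1+n (suc n)) (λ (i : Fin (suc (suc n))) → orbit (toℕ i))
  ... | i , j , i<j , orbitᵢ≡orbitⱼ =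
    subst (λ t → orbit t ≡ zero) (≤-antisym (≤-trans (m∸n≤m (toℕ j) (toℕ i)) (≤-pred (toℕ<n j))) n<d) returns
    where
    returns : orbit (toℕ j ∸ toℕ i) ≡ zero
    returns = orbit-returns (toℕ i) _ (trans (cong orbit (m+[n∸m]≡n (<⇒≤ i<j))) (sym orbitᵢ≡orbitⱼ))
    n<d : suc n ≤ toℕ j ∸ toℕ i
    n<d = orbit-return-time _ returns {{>-nonZero (m<n⇒0<n∸m i<j)}}

  orbit-no-early-return : ∀ {s t} → s ℕ.< t → t ≤ n → orbit s ≢ orbit t
  orbit-no-early-return {s} {t} s<t t≤n e = <-irrefl refl (≤-trans n<t∸s (≤-trans (m∸n≤m t s) t≤n))
    where
    n<t∸s : suc n ≤ t ∸ s
    n<t∸s = orbit-return-time _ (orbit-returns s _ (trans (cong orbit (m+[n∸m]≡n (<⇒≤ s<t))) (sym e)))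
                              {{>-nonZero (m<n⇒0<n∸m s<t)}}

  orbit-injective : ∀ a b → orbit (toℕ {suc n} a) ≡ orbit (toℕ b) → a ≡ b
  orbit-injective a b e with <-cmp (toℕ a) (toℕ b)
  ... | tri≈ _ a≡b _ = toℕ-injective a≡b
  ... | tri< a<b _ _ = ⊥-elim (orbit-no-early-return a<b (≤-pred (toℕ<n b)) e)
  ... | tri> _ _ b<a = ⊥-elim (orbit-no-early-return b<a (≤-pred (toℕ<n a)) (sym e))

  orbitPerm : Permutation′ (suc n)
  orbitPerm = permutation (λ v → orbit (toℕ v)) (λ y → proj₁ (orbit-covers (suc n) orbit-period y))
    (λ y → proj₂ (orbit-covers (suc n) orbit-period y))
    (λ v → orbit-injective _ v (proj₂ (orbit-covers (suc n) orbit-period (orbit (toℕ v)))))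

  orbitPerm-sucCyc : ∀ v → orbitPerm ⟨$⟩ʳ sucCyc v ≡ φ ⟨$⟩ʳ (orbitPerm ⟨$⟩ʳ v)
  orbitPerm-sucCyc v with fromℕ-or-inject₁ v
  ... | inj₁ refl = trans (cong (orbit ∘ toℕ) (sucCyc-fromℕ n))
                          (sym (trans (cong (orbit ∘ suc) (toℕ-fromℕ n)) orbit-period))
  ... | inj₂ (y , refl) = trans (cong (orbit ∘ toℕ) (sucCyc-inject₁ y)) (cong (orbit ∘ suc) (sym (toℕ-inject₁ y)))

  -- Indexing from 0, flip τ is the σ with σ⁻¹(v) = φ^(v+1)(0); it sends 0 to n, so it is some π′.
  Φ-′-surjective : ∃[ π ] Φ (π ′) ≈ φ
  Φ-′-surjective =
    let π , π′≈σ = ′-surjective (flip τ) σ-zero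
    in  π , λ x → trans (Φ-cong {σ = π ′} {flip τ} π′≈σ x) (Φ-flip τ φ τ-intertwines x)
    where
    τ : Permutation′ (suc n)
    τ = orbitPerm ∘ₚ φ
    τ-intertwines : ∀ v → τ ⟨$⟩ʳ sucCyc v ≡ φ ⟨$⟩ʳ (τ ⟨$⟩ʳ v)
    τ-intertwines v = cong (φ ⟨$⟩ʳ_) (orbitPerm-sucCyc v)
    τ-fromℕ : τ ⟨$⟩ʳ fromℕ n ≡ zero
    τ-fromℕ = trans (sym (orbitPerm-sucCyc (fromℕ n))) (cong (orbit ∘ toℕ) (sucCyc-fromℕ n))
    σ-zero : flip τ ⟨$⟩ʳ zero ≡ fromℕ n
    σ-zero = trans (cong (τ ⟨$⟩ˡ_) (sym τ-fromℕ)) (inverseˡ τ)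

countUpTo : ∀ {n p} {P : Pred (Fin n) p} → Decidable P → Fin n → ℕ
countUpTo {n} P? a = length (filter P? (take (suc (toℕ a)) (allFin n)))

module _ {m p} {P : Pred (Fin (suc m)) p} (P? : Decidable P) where

  countUpTo-zero : ¬ P zero → countUpTo P? zero ≡ 0
  countUpTo-zero ¬P0 = cong length (filter-reject P? ¬P0)

  countUpTo-suc : ∀ j → countUpTo P? (suc j) ≡ countUpTo P? (inject₁ j) + length (filter P? [ suc j ])
  countUpTo-suc j = begin
    countUpTo P? (suc j)                                    ≡⟨ cong (length ∘ filter P?) take-suc ⟩
    length (filter P? (prefix ∷ʳ suc j))                    ≡⟨ cong length (filter-++ P? prefix [ suc j ]) ⟩
    length (filter P? prefix ++ filter P? [ suc j ])        ≡⟨ length-++ (filter P? prefix) ⟩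
    countUpTo P? (inject₁ j) + length (filter P? [ suc j ]) ∎
    where
    open ≡-Reasoning
    prefix : List (Fin (suc m))
    prefix = take (suc (toℕ (inject₁ j))) (allFin (suc m))
    take-suc : take (suc (toℕ (suc j))) (allFin (suc m)) ≡ prefix ∷ʳ suc j
    take-suc = trans (take-suc-tabulate id (suc j))
                     (cong (λ t → take (suc t) (allFin (suc m)) ∷ʳ suc j) (sym (toℕ-inject₁ j)))

  countUpTo-accept : ∀ {j} → P (suc j) → countUpTo P? (suc j) ≡ suc (countUpTo P? (inject₁ j))
  countUpTo-accept {j} Pj = trans (countUpTo-suc j)
    (trans (cong (λ xs → countUpTo P? (inject₁ j) + length xs) (filter-accept P? Pj)) (+-comm _ 1))

  countUpTo-reject : ∀ {j} → ¬ P (suc j) → countUpTo P? (suc j) ≡ countUpTo P? (inject₁ j)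
  countUpTo-reject {j} ¬Pj = trans (countUpTo-suc j)
    (trans (cong (λ xs → countUpTo P? (inject₁ j) + length xs) (filter-reject P? ¬Pj)) (+-identityʳ _))

  countUpTo-fromℕ : countUpTo P? (fromℕ m) ≡ length (filter P? (allFin (suc m)))
  countUpTo-fromℕ = trans (cong (λ t → length (filter P? (take (suc t) (allFin (suc m))))) (toℕ-fromℕ m))
    (cong (length ∘ filter P?) (take-all (suc m) (allFin (suc m)) (≤-reflexive (length-tabulate id))))

  countUpTo-≤-all : ∀ a → countUpTo P? a ≤ length (filter P? (allFin (suc m)))
  countUpTo-≤-all a = begin
    countUpTo P? a                                                  ≤⟨ m≤m+n _ _ ⟩
    length (filter P? (take t xs)) + length (filter P? (drop t xs)) ≡⟨ sym (length-++ (filter P? (take t xs))) ⟩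
    length (filter P? (take t xs) ++ filter P? (drop t xs))         ≡⟨ cong length (sym (filter-++ P? (take t xs) _)) ⟩
    length (filter P? (take t xs ++ drop t xs))                     ≡⟨ cong (length ∘ filter P?) (take++drop≡id t xs) ⟩
    length (filter P? xs)                                           ∎
    where
    open ≤-Reasoning
    t : ℕ
    t = suc (toℕ a)
    xs : List (Fin (suc m))
    xs = allFin (suc m)

  countUpTo-dominated : ¬ P zero → (L : Fin (suc m) → ℕ) → (∀ j → L (inject₁ j) ≤ L (suc j)) →
    (∀ j → P (suc j) → L (inject₁ j) ℕ.< L (suc j)) → ∀ a → countUpTo P? a + L zero ≤ L a
  countUpTo-dominated ¬P0 L L-step-≤ L-step-< = <-weakInduction _ base step
    where
    base : countUpTo P? zero + L zero ≤ L zero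
    base = ≤-reflexive (cong (_+ L zero) (countUpTo-zero ¬P0))
    step : ∀ j → countUpTo P? (inject₁ j) + L zero ≤ L (inject₁ j) → countUpTo P? (suc j) + L zero ≤ L (suc j)
    step j ih with P? (suc j)
    ... | yes Pj = ≤-trans (≤-reflexive (cong (_+ L zero) (countUpTo-accept Pj))) (≤-trans (s≤s ih) (L-step-< j Pj))
    ... | no ¬Pj = ≤-trans (≤-reflexive (cong (_+ L zero) (countUpTo-reject ¬Pj))) (≤-trans ih (L-step-≤ j))

inject₁<suc : ∀ {n} (j : Fin n) → inject₁ j < suc j
inject₁<suc j = s≤s (≤-reflexive (toℕ-inject₁ j))

stepwise⇒increasing : ∀ {a ℓ} {A : Set a} {_≺_ : Rel A ℓ} → Transitive _≺_ →
  ∀ {m} (f : Fin (suc m) → A) → (∀ j → f (inject₁ j) ≺ f (suc j)) → ∀ {i j} → i < j → f i ≺ f j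
stepwise⇒increasing {_≺_ = _≺_} ≺-trans f step {i} {j} = <-weakInduction (λ j → i < j → f i ≺ f j) (λ ()) extend j
  where
  extend : ∀ j → (i < inject₁ j → f i ≺ f (inject₁ j)) → i < suc j → f i ≺ f (suc j)
  extend j ih i<1+j with m≤n⇒m<n∨m≡n (≤-pred i<1+j)
  ... | inj₁ i<j = ≺-trans (ih (subst (toℕ i ℕ.<_) (sym (toℕ-inject₁ j)) i<j)) (step j)
  ... | inj₂ i≡j = subst (λ x → f x ≺ f (suc j)) (toℕ-injective (trans (toℕ-inject₁ j) (sym i≡j))) (step j)

-- Positions range over Fin (suc n); position n (fromℕ n) starts the empty suffix.
suffixFrom : ∀ {k n} → Word k n → Fin (suc n) → List (Fin k)
suffixFrom w p = drop (toℕ p) (toList w)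

suffix≡suffixFrom : ∀ {k n} (w : Word k n) p → suffix w p ≡ suffixFrom w (inject₁ p)
suffix≡suffixFrom w p = cong (λ t → drop t (toList w)) (sym (toℕ-inject₁ p))

suffixFrom-inject₁ : ∀ {k n} (w : Word k n) p → suffixFrom w (inject₁ p) ≡ lookup w p ∷ suffixFrom w (suc p)
suffixFrom-inject₁ w p = trans (cong (λ t → drop t (toList w)) (toℕ-inject₁ p)) (drop-toList w p)
  where
  drop-toList : ∀ {A : Set} {n} (v : Vec A n) i → drop (toℕ i) (toList v) ≡ lookup v i ∷ drop (suc (toℕ i)) (toList v)
  drop-toList (x ∷ v) zero    = refl
  drop-toList (x ∷ v) (suc i) = drop-toList v i

suffixFrom-fromℕ : ∀ {k n} (w : Word k n) → suffixFrom w (fromℕ n) ≡ []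
suffixFrom-fromℕ {n = n} w = trans (cong (λ t → drop t (toList w)) (toℕ-fromℕ n)) (drop-all w)
  where
  drop-all : ∀ {A : Set} {n} (v : Vec A n) → drop n (toList v) ≡ []
  drop-all []      = refl
  drop-all (x ∷ v) = drop-all v

<lex-asym : ∀ {k} → Asymmetric (_<lex_ {k})
<lex-asym = <-asymmetric sym (resp₂ _<_) <-asym

-- Induction from the end of the word: each comparison of suffixes reduces to one between their tails.
suffixFrom-<lex-by-rank : ∀ {k n} (w : Word k n) (rank : Fin (suc n) → Fin (suc n)) → rank (fromℕ n) ≡ zero →
  (∀ p q → rank (inject₁ p) < rank (inject₁ q) →
     ×-Lex _≡_ _<_ _<_ (lookup w p , rank (suc p)) (lookup w q , rank (suc q))) →
  ∀ p q → rank p < rank q → suffixFrom w p <lex suffixFrom w q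
suffixFrom-<lex-by-rank {n = n} w rank rank-fromℕ ordered =
  >-weakInduction (λ p → ∀ q → rank p < rank q → suffixFrom w p <lex suffixFrom w q) empty nonempty
  where
  above-rank : ∀ {p} q → rank p < rank q → ∃[ q′ ] q ≡ inject₁ q′
  above-rank {p} q rp<rq with fromℕ-or-inject₁ q
  ... | inj₁ refl = ⊥-elim (n≮0 (subst (λ r → rank p < r) rank-fromℕ rp<rq))
  ... | inj₂ q≡q′ = q≡q′

  empty : ∀ q → rank (fromℕ n) < rank q → suffixFrom w (fromℕ n) <lex suffixFrom w q
  empty q r< with above-rank q r<
  ... | q′ , refl rewrite suffixFrom-fromℕ w | suffixFrom-inject₁ w q′ = halt

  nonempty : ∀ p → (∀ q → rank (suc p) < rank q → suffixFrom w (suc p) <lex suffixFrom w q) →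
                   ∀ q → rank (inject₁ p) < rank q → suffixFrom w (inject₁ p) <lex suffixFrom w q
  nonempty p ih q r< with above-rank q r<
  ... | q′ , refl rewrite suffixFrom-inject₁ w p | suffixFrom-inject₁ w q′ with ordered p q′ r<
  ...   | inj₁ wp<wq             = this wp<wq
  ...   | inj₂ (wp≡wq , tail-r<) = next wp≡wq (ih (suc q′) tail-r<)

Descent : ∀ {n} → Permutation′ (suc n) → Pred (Fin n) 0ℓ
Descent φ i = ¬ (toℕ i ≡ 0) × φ ⟨$⟩ʳ suc i < φ ⟨$⟩ʳ inject₁ i

descent? : ∀ {n} (φ : Permutation′ (suc n)) → Decidable (Descent φ)
descent? φ i = ¬? (toℕ i ℕ.≟ 0) ×-dec (φ ⟨$⟩ʳ suc i <? φ ⟨$⟩ʳ inject₁ i)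

¬Descent-zero : ∀ {m} (φ : Permutation′ (suc (suc m))) → ¬ Descent φ zero
¬Descent-zero φ (0≢0 , _) = 0≢0 refl

descentsExcept1≡countUpTo : ∀ {m} (φ : Permutation′ (suc (suc m))) →
  descentsExcept1 φ ≡ countUpTo (descent? φ) (fromℕ m)
descentsExcept1≡countUpTo φ = sym (countUpTo-fromℕ (descent? φ))

module _ {k m} {π : Permutation′ (suc m)} {w : Word k (suc m)} (sa : IsSuffixArray w π) where

  ′-sorted : ∀ r s → r < s → suffixFrom w (π ′ ⟨$⟩ʳ r) <lex suffixFrom w (π ′ ⟨$⟩ʳ s)
  ′-sorted zero    (suc s) _ rewrite suffixFrom-fromℕ w | suffixFrom-inject₁ w (π ⟨$⟩ʳ s) = halt
  ′-sorted (suc r) (suc s) r<s =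
    subst₂ _<lex_ (suffix≡suffixFrom w (π ⟨$⟩ʳ r)) (suffix≡suffixFrom w (π ⟨$⟩ʳ s)) (sa r s (≤-pred r<s))

  ′-⟨$⟩ˡ-<lex : ∀ p q → suffixFrom w p <lex suffixFrom w q → π ′ ⟨$⟩ˡ p < π ′ ⟨$⟩ˡ q
  ′-⟨$⟩ˡ-<lex p q p<q with <-cmp (toℕ (π ′ ⟨$⟩ˡ p)) (toℕ (π ′ ⟨$⟩ˡ q))
  ... | tri< r<s _ _ = r<s
  ... | tri≈ _ r≡s _ = ⊥-elim (<lex-asym p<p p<p)
    where
    p<p : suffixFrom w p <lex suffixFrom w p
    p<p = subst (λ x → suffixFrom w p <lex suffixFrom w x)
                (⟨$⟩ʳ-injective (flip (π ′)) {q} {p} (toℕ-injective (sym r≡s))) p<q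
  ... | tri> _ _ s<r = ⊥-elim (<lex-asym p<q
    (subst₂ (λ x y → suffixFrom w x <lex suffixFrom w y) (inverseʳ (π ′) {q}) (inverseʳ (π ′) {p})
            (′-sorted (π ′ ⟨$⟩ˡ q) (π ′ ⟨$⟩ˡ p) s<r)))

  sorted-heads : ∀ {i j} → i < j →
    ×-Lex _≡_ _<_ _<lex_ (lookup w (π ⟨$⟩ʳ i) , suffixFrom w (suc (π ⟨$⟩ʳ i)))
                          (lookup w (π ⟨$⟩ʳ j) , suffixFrom w (suc (π ⟨$⟩ʳ j)))
  sorted-heads {i} {j} i<j = toSum (subst₂ _<lex_ (split i) (split j) (sa i j i<j))
    where
    split : ∀ i → suffix w (π ⟨$⟩ʳ i) ≡ lookup w (π ⟨$⟩ʳ i) ∷ suffixFrom w (suc (π ⟨$⟩ʳ i))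
    split i = trans (suffix≡suffixFrom w (π ⟨$⟩ʳ i)) (suffixFrom-inject₁ w (π ⟨$⟩ʳ i))

  headOfRank : Fin (suc m) → ℕ
  headOfRank a = toℕ (lookup w (π ⟨$⟩ʳ a))

  headOfRank-step-≤ : ∀ j → headOfRank (inject₁ j) ≤ headOfRank (suc j)
  headOfRank-step-≤ j with sorted-heads (inject₁<suc j)
  ... | inj₁ wᵢ<wⱼ       = <⇒≤ wᵢ<wⱼ
  ... | inj₂ (wᵢ≡wⱼ , _) = ≤-reflexive (cong toℕ wᵢ≡wⱼ)

  -- With equal first letters the tails are sorted, and their ranks are the values of Φ(π′) at the two ranks.
  headOfRank-step-< : ∀ j → Descent (Φ (π ′)) (suc j) → headOfRank (inject₁ j) ℕ.< headOfRank (suc j)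
  headOfRank-step-< j (_ , descent) with sorted-heads (inject₁<suc j)
  ... | inj₁ wᵢ<wⱼ            = wᵢ<wⱼ
  ... | inj₂ (_ , tailᵢ<tailⱼ) = ⊥-elim (<-asym descent
    (subst₂ _<_ (sym (Φ-′-suc π (inject₁ j))) (sym (Φ-′-suc π (suc j))) (′-⟨$⟩ˡ-<lex _ _ tailᵢ<tailⱼ)))

  descentsExcept1-≤-letters : descentsExcept1 (Φ (π ′)) ≤ k ∸ 1
  descentsExcept1-≤-letters = begin
    descentsExcept1 (Φ (π ′))                                  ≡⟨ descentsExcept1≡countUpTo (Φ (π ′)) ⟩
    countUpTo (descent? (Φ (π ′))) (fromℕ m)                   ≤⟨ m≤m+n _ _ ⟩
    countUpTo (descent? (Φ (π ′))) (fromℕ m) + headOfRank zero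
      ≤⟨ countUpTo-dominated (descent? (Φ (π ′))) (¬Descent-zero (Φ (π ′)))
                             headOfRank headOfRank-step-≤ headOfRank-step-< (fromℕ m) ⟩
    headOfRank (fromℕ m)                                       ≤⟨ ∸-monoˡ-≤ 1 (toℕ<n (lookup w (π ⟨$⟩ʳ fromℕ m))) ⟩
    k ∸ 1                                                      ∎
    where open ≤-Reasoning

module _ {k m} (k≥1 : 1 ≤ k) (π : Permutation′ (suc m)) (φ : Permutation′ (suc (suc m)))
         (Φπ′≈φ : Φ (π ′) ≈ φ) (few-descents : descentsExcept1 φ ≤ k ∸ 1) where

  countUpTo-descent<k : ∀ a → countUpTo (descent? φ) a ℕ.< k
  countUpTo-descent<k a = subst (countUpTo (descent? φ) a ℕ.<_) (m+[n∸m]≡n k≥1)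
                                (s≤s (≤-trans (countUpTo-≤-all (descent? φ) a) few-descents))

  letterOfRank : Fin (suc m) → Fin k
  letterOfRank a = fromℕ< (countUpTo-descent<k a)

  letterOfRank-φ-increasing : ∀ {a b} → a < b →
    ×-Lex _≡_ _<_ _<_ (letterOfRank a , φ ⟨$⟩ʳ suc a) (letterOfRank b , φ ⟨$⟩ʳ suc b)
  letterOfRank-φ-increasing =
    stepwise⇒increasing {_≺_ = ×-Lex _≡_ _<_ _<_}
      (×-transitive {_≈₁_ = _≡_} {_<₁_ = _<_ {k}} {_<₂_ = _<_ {suc (suc m)}} isEquivalence (resp₂ _<_) <-trans <-trans)
      (λ a → letterOfRank a , φ ⟨$⟩ʳ suc a) step
    where
    step : ∀ j → ×-Lex _≡_ _<_ _<_ (letterOfRank (inject₁ j) , φ ⟨$⟩ʳ suc (inject₁ j))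
                                   (letterOfRank (suc j) , φ ⟨$⟩ʳ suc (suc j))
    step j with descent? φ (suc j)
    ... | yes descent = inj₁ (subst₂ ℕ._<_ (sym (toℕ-fromℕ< (countUpTo-descent<k (inject₁ j))))
                                           (sym (toℕ-fromℕ< (countUpTo-descent<k (suc j))))
                                           (≤-reflexive (sym (countUpTo-accept (descent? φ) descent))))
    ... | no ¬descent = inj₂ (fromℕ<-cong _ _ (sym (countUpTo-reject (descent? φ) ¬descent)) _ _ , ascent)
      where
      ascent : φ ⟨$⟩ʳ suc (inject₁ j) < φ ⟨$⟩ʳ suc (suc j)
      ascent = ≤∧≢⇒< (≮⇒≥ (λ d → ¬descent ((λ ()) , d)))
                     (λ e → <-irrefl (cong toℕ (⟨$⟩ʳ-injective φ (toℕ-injective e))) (s≤s (inject₁<suc j)))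

  wordOfRanks : Word k (suc m)
  wordOfRanks = Vec.tabulate (λ p → letterOfRank (π ⟨$⟩ˡ p))

  ′-⟨$⟩ˡ-suc : ∀ p → π ′ ⟨$⟩ˡ suc p ≡ φ ⟨$⟩ʳ suc (π ⟨$⟩ˡ p)
  ′-⟨$⟩ˡ-suc p = trans (cong (λ x → π ′ ⟨$⟩ˡ suc x) (sym (inverseʳ π)))
                       (trans (sym (Φ-′-suc π (π ⟨$⟩ˡ p))) (Φπ′≈φ (suc (π ⟨$⟩ˡ p))))

  wordOfRanks-suffixArray : IsSuffixArray wordOfRanks π
  wordOfRanks-suffixArray i j i<j =
    subst₂ _<lex_ (sym (suffix≡suffixFrom wordOfRanks (π ⟨$⟩ʳ i))) (sym (suffix≡suffixFrom wordOfRanks (π ⟨$⟩ʳ j)))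
      (suffixFrom-<lex-by-rank wordOfRanks (π ′ ⟨$⟩ˡ_) (inverseˡ (π ′)) ordered
        (inject₁ (π ⟨$⟩ʳ i)) (inject₁ (π ⟨$⟩ʳ j)) (subst₂ _<_ (sym (rank-π i)) (sym (rank-π j)) (s≤s i<j)))
    where
    rank-π : ∀ i → π ′ ⟨$⟩ˡ inject₁ (π ⟨$⟩ʳ i) ≡ suc i
    rank-π i = trans (′-⟨$⟩ˡ-inject₁ π (π ⟨$⟩ʳ i)) (cong suc (inverseˡ π))
    ordered : ∀ p q → π ′ ⟨$⟩ˡ inject₁ p < π ′ ⟨$⟩ˡ inject₁ q →
      ×-Lex _≡_ _<_ _<_ (lookup wordOfRanks p , π ′ ⟨$⟩ˡ suc p) (lookup wordOfRanks q , π ′ ⟨$⟩ˡ suc q)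
    ordered p q r< rewrite lookup∘tabulate (λ p → letterOfRank (π ⟨$⟩ˡ p)) p
                         | lookup∘tabulate (λ p → letterOfRank (π ⟨$⟩ˡ p)) q
                         | ′-⟨$⟩ˡ-suc p | ′-⟨$⟩ˡ-suc q =
      letterOfRank-φ-increasing (≤-pred (subst₂ _<_ (′-⟨$⟩ˡ-inject₁ π p) (′-⟨$⟩ˡ-inject₁ π q) r<))

suffixArray⇒few-descents : ∀ {k n} (π : Permutation′ n) → IsSuffixArrayOfWord k π →
  descentsExcept1 (Φ (π ′)) ≤ k ∸ 1
suffixArray⇒few-descents {n = zero}  π _        = z≤n
suffixArray⇒few-descents {n = suc m} π (w , sa) = descentsExcept1-≤-letters sa

few-descents⇒suffixArray : ∀ {k n} → 1 ≤ k → (π : Permutation′ n) (φ : Permutation′ (suc n)) → Φ (π ′) ≈ φ →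
  descentsExcept1 φ ≤ k ∸ 1 → IsSuffixArrayOfWord k π
few-descents⇒suffixArray {n = zero}  k≥1 π φ Φπ′≈φ few = [] , λ ()
few-descents⇒suffixArray {n = suc m} k≥1 π φ Φπ′≈φ few =
  wordOfRanks k≥1 π φ Φπ′≈φ few , wordOfRanks-suffixArray k≥1 π φ Φπ′≈φ few

mainTheorem8 : (k n : ℕ) → 1 ≤ k →
    ((π : Permutation′ n) → IsSuffixArrayOfWord k π →
       IsCyclic (Φ (π ′)) × descentsExcept1 (Φ (π ′)) ≤ k ∸ 1)
  × ((π₁ π₂ : Permutation′ n) → IsSuffixArrayOfWord k π₁ → IsSuffixArrayOfWord k π₂ →
       Φ (π₁ ′) ≈ Φ (π₂ ′) → π₁ ≈ π₂)
  × ((φ : Permutation′ (suc n)) → IsCyclic φ → descentsExcept1 φ ≤ k ∸ 1 →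
       ∃[ π ] (IsSuffixArrayOfWord k π × Φ (π ′) ≈ φ
               × ((i : Fin n) → ix (π ⟨$⟩ˡ i) ≡ ix (iter (ix i) (φ ⟨$⟩ʳ_) zero) ∸ 1)))
mainTheorem8 k n k≥1 =
    (λ π sa → Φ-cyclic (π ′) , suffixArray⇒few-descents π sa)
  , (λ π₁ π₂ _ _ → Φ-′-injective π₁ π₂)
  , λ φ cyclic few →
      let π , Φπ′≈φ = Φ-′-surjective φ cyclic
      in  π , few-descents⇒suffixArray k≥1 π φ Φπ′≈φ few , Φπ′≈φ , ′-inverse-via-orbit π φ Φπ′≈φ
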